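{- Let $s\ge 1$ be an integer. If a graph $G$ contains an $s$-geodesically covered cycle, then $G$ contains a finite locally $s$-isometric subgraph. In particular, if $G$ is $(s,s-1)$-dismantlable, then $G$ does not contain $s$-geodesically covered cycles.
   Context: Graphs are undirected, connected, simple, possibly infinite; $d$ is the shortest-path distance; a geodesic is a shortest path of $G$. A subgraph $H$ of $G$ is locally $s$-isometric if $H$ contains a collection $\mathcal P$ of geodesics of $G$ such that for every vertex $v$ of $H$ there is $P\in\mathcal P$ through $v$ whose endvertices $x,y$ satisfy $d(v,x)\ge s$, $d(v,y)\ge s$. A cycle $c$ of $G$ is $s$-geodesically covered if there is a set $\mathcal P=\{P_0,\ldots,P_{n-1}\}$ of geodesics of $G$ such that (i) each $P_i$ is a subpath of $c$, (ii) each edge of $c$ lies in some geodesic of $\mathcal P$, (iii) if $P_i,P_j$ are not consecutive (modulo $n$) then they are edge-disjoint, and (iv) if $j=i+1 \bmod n$ then $P_i\cap P_j$ is a path of length at least $2s$. With $B_r(v,G)=\{x:d(v,x)\le r\}$, $B_r(v,G-\{u\})$ the ball in $G$ minus $u$, and $X_v=\{w: w\preceq v\}$ for a well-order $\preceq$ on $V$: $G$ is $(s,s')$-dismantlable if $V$ admits a well-order $\preceq$ such that for each vertex $v$ (other than the least element) there is $u\ne v$, $u\preceq v$, with $B_s(v,G-\{u\})\cap X_v\subseteq B_{s'}(u,G)$. -}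

module Defs where

open import Level using (Level) renaming (suc to lsuc; zero to lzero)
open import Data.Nat using (ℕ; zero; suc; _+_; _*_; _∸_; _≤_; _<_; NonZero; >-nonZero; s≤s; z≤n)
open import Data.Nat.DivMod using (_mod_)
open import Data.Fin using (Fin; toℕ; inject₁; fromℕ) renaming (zero to fzero; suc to fsuc)
open import Data.List using (List)
open import Data.List.Membership.Propositional using (_∈_)
open import Data.Product using (Σ; ∃; ∃-syntax; _×_; _,_)
open import Data.Sum using (_⊎_)
open import Relation.Nullary using (¬_)
open import Relation.Binary.PropositionalEquality using (_≡_; _≢_)
open import Function.Definitions using (Injective)
open import Function.Bundles using (_⇔_)
open import Induction.WellFounded using (WellFounded)

record Graph : Set₁ where
  field
    V     : Set
    _~_   : V → V → Set
    ~-sym : ∀ {x y} → x ~ y → y ~ x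
    ~-irr : ∀ {x} → ¬ (x ~ x)

module _ (G : Graph) where
  open Graph G

  record Walk : Set where
    field
      len : ℕ
      vtx : Fin (suc len) → V
      adj : (k : Fin len) → vtx (inject₁ k) ~ vtx (fsuc k)

  start end : Walk → V
  start W = Walk.vtx W fzero
  end   W = Walk.vtx W (fromℕ (Walk.len W))

  record Path : Set where
    field
      walk : Walk
      inj  : Injective _≡_ _≡_ (Walk.vtx walk)
    open Walk walk public

  pstart pend : Path → V
  pstart P = start (Path.walk P)
  pend   P = end (Path.walk P)

  VtxOf : Path → V → Set
  VtxOf P x = ∃[ k ] x ≡ Path.vtx P k

  EdgeOf : Path → V → V → Set
  EdgeOf P x y = ∃[ k ] ((x ≡ Path.vtx P (inject₁ k) × y ≡ Path.vtx P (fsuc k))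
                        ⊎ (y ≡ Path.vtx P (inject₁ k) × x ≡ Path.vtx P (fsuc k)))

  Connected : Set
  Connected = ∀ x y → ∃[ W ] (start W ≡ x × end W ≡ y)

  DistGe : V → V → ℕ → Set
  DistGe x y r = ∀ (W : Walk) → start W ≡ x → end W ≡ y → r ≤ Walk.len W

  InBall : ℕ → V → V → Set
  InBall r x y = ∃[ W ] (start W ≡ x × end W ≡ y × Walk.len W ≤ r)

  -- y ∈ B_r(x, G - {u})  (x ≠ u assumed by the caller)
  InBallMinus : V → ℕ → V → V → Set
  InBallMinus u r x y =
    ∃[ W ] (start W ≡ x × end W ≡ y × Walk.len W ≤ r × (∀ k → Walk.vtx W k ≢ u))

  Geodesic : Path → Set
  Geodesic P = DistGe (pstart P) (pend P) (Path.len P)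

  record Subgraph : Set₁ where
    field
      VS    : V → Set
      ES    : V → V → Set
      ES-adj : ∀ {x y} → ES x y → x ~ y
      ES-sym : ∀ {x y} → ES x y → ES y x
      ES-vtx : ∀ {x y} → ES x y → VS x × VS y

  FiniteSub : Subgraph → Set
  FiniteSub H = ∃[ xs ] (∀ x → Subgraph.VS H x → x ∈ xs)

  NonEmptySub : Subgraph → Set
  NonEmptySub H = ∃[ v ] Subgraph.VS H v

  PathIn : Path → Subgraph → Set
  PathIn P H = (∀ x → VtxOf P x → Subgraph.VS H x)
             × (∀ x y → EdgeOf P x y → Subgraph.ES H x y)

  LocallyIsometric : ℕ → Subgraph → Set₁
  LocallyIsometric s H =
    Σ (Path → Set) λ 𝒫 →
      (∀ P → 𝒫 P → Geodesic P × PathIn P H)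
      × (∀ v → Subgraph.VS H v →
           ∃[ P ] (𝒫 P × VtxOf P v × DistGe v (pstart P) s × DistGe v (pend P) s))

  atMod : ∀ {n} → 3 ≤ n → (Fin n → V) → ℕ → V
  atMod {suc n} _ c k = c (k mod suc n)

  record Cycle : Set where
    field
      len   : ℕ
      len≥3 : 3 ≤ len
      cv    : Fin len → V
      inj   : Injective _≡_ _≡_ cv

    at : ℕ → V
    at k = atMod len≥3 cv k

    field
      adj : ∀ k → at k ~ at (suc k)

  SubpathOf : Path → Cycle → Set
  SubpathOf P c =
    Path.len P < Cycle.len c ×
    ∃[ a ] ((∀ k → Path.vtx P k ≡ Cycle.at c (a + toℕ k))
          ⊎ (∀ k → Path.vtx P k ≡ Cycle.at c (a + (Path.len P ∸ toℕ k))))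

  Consec : (m : ℕ) → Fin m → Fin m → Set
  Consec m i j = (toℕ j ≡ suc (toℕ i)) ⊎ (suc (toℕ i) ≡ m × toℕ j ≡ 0)

  EdgeDisjoint : Path → Path → Set
  EdgeDisjoint P Q = ∀ x y → ¬ (EdgeOf P x y × EdgeOf Q x y)

  IntersectionIsPathGe : Path → Path → ℕ → Set
  IntersectionIsPathGe P Q r =
    ∃[ R ] (r ≤ Path.len R
           × (∀ x → (VtxOf P x × VtxOf Q x) ⇔ VtxOf R x)
           × (∀ x y → (EdgeOf P x y × EdgeOf Q x y) ⇔ EdgeOf R x y))

  GeodesicallyCovered : ℕ → Cycle → Set
  GeodesicallyCovered s c =
    ∃[ m ] Σ (Fin m → Path) λ P →
      (∀ i → Geodesic (P i) × SubpathOf (P i) c)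
      × (∀ e → ∃[ i ] EdgeOf (P i) (Cycle.at c e) (Cycle.at c (suc e)))
      × (∀ i j → i ≢ j → ¬ Consec m i j → ¬ Consec m j i → EdgeDisjoint (P i) (P j))
      × (∀ i j → Consec m i j → IntersectionIsPathGe (P i) (P j) (2 * s))

  HasGeodCoveredCycle : ℕ → Set
  HasGeodCoveredCycle s = ∃[ c ] GeodesicallyCovered s c

  record WellOrder : Set₁ where
    field
      _≼_     : V → V → Set
      refl    : ∀ x → x ≼ x
      antisym : ∀ {x y} → x ≼ y → y ≼ x → x ≡ y
      trans   : ∀ {x y z} → x ≼ y → y ≼ z → x ≼ z
      total   : ∀ x y → (x ≼ y) ⊎ (y ≼ x)
      wf      : WellFounded (λ x y → x ≼ y × x ≢ y)

  Dismantlable : ℕ → ℕ → Set₁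
  Dismantlable s s' =
    Σ WellOrder λ O → let open WellOrder O in
      ∀ v → ¬ (∀ w → v ≼ w) →
        ∃[ u ] (u ≢ v × u ≼ v ×
          (∀ x → InBallMinus u s v x → x ≼ v → InBall s' u x))

module Submission where

-- Read the covered cycle as ℤ/N and each covering geodesic as an arc of it.
-- Being geodesic, an arc spans at most half of the cycle; cutting the cycle
-- open then shows that the end of each arc lies strictly inside another arc,
-- necessarily a cyclic neighbour, which overlaps it in at least 2s edges
-- before that end. Hence (using also the mirror image of the cycle) every
-- cycle vertex lies at distance ≥ s from both ends of some covering geodesic
-- through it, so the cycle itself is a finite locally s-isometric subgraph.
-- In an (s, s-1)-dismantling order the last cycle vertex v is such a deep
-- vertex; the vertex u assigned to v avoids one of the two length-s halves of
-- that geodesic around v, and joining the two far ends through u gives a walk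
-- shorter than their distance 2s.

open import Defs
open import Data.Nat
open import Data.Nat.Properties
open import Data.Nat.DivMod
open import Data.Fin using (Fin; toℕ; fromℕ<; fromℕ; inject₁; inject≤)
  renaming (zero to fzero; suc to fsuc)
open import Data.Fin.Properties
  using (toℕ-fromℕ<; toℕ-injective; toℕ<n; toℕ-inject₁; toℕ-fromℕ; injective⇒≤; inject≤-injective; any?)
open import Data.Product
open import Data.Sum using (_⊎_; inj₁; inj₂)
open import Data.Empty using (⊥; ⊥-elim)
open import Relation.Nullary using (¬_; Dec; yes; no)
open import Relation.Nullary.Decidable using (map′; _×-dec_; decidable-stable; ¬¬-excluded-middle)
open import Relation.Binary using (Rel; Setoid; IsEquivalence; Reflexive; Transitive; Total)
open import Relation.Binary.PropositionalEquality hiding ([_])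
open import Function using (_∘_; case_of_)
open import Function.Definitions using (Injective)
open import Function.Bundles using (Equivalence)
import Data.List as List
open import Data.List using (allFin)
open import Data.List.Membership.Propositional using (_∈_)
open import Data.List.Membership.Propositional.Properties using (∈-map⁺; ∈-allFin)
import Relation.Binary.Reasoning.Setoid

module Modular (n : ℕ) where

  N : ℕ
  N = suc n

  infix 4 _≡ₙ_ _≡ₙ?_
  record _≡ₙ_ (x y : ℕ) : Set where
    constructor modeq
    field unmod : x % N ≡ y % N
  open _≡ₙ_ public

  ≡ₙ-isEquivalence : IsEquivalence _≡ₙ_
  ≡ₙ-isEquivalence = record
    { refl  = modeq refl
    ; sym   = λ (modeq e) → modeq (sym e)
    ; trans = λ (modeq e) (modeq f) → modeq (trans e f) }

  ≡ₙ-setoid : Setoid _ _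
  ≡ₙ-setoid = record { isEquivalence = ≡ₙ-isEquivalence }

  open IsEquivalence ≡ₙ-isEquivalence public
    renaming (refl to ≡ₙ-refl; sym to ≡ₙ-sym; trans to ≡ₙ-trans; reflexive to ≡⇒≡ₙ)

  module ≡ₙ-Reasoning = Relation.Binary.Reasoning.Setoid ≡ₙ-setoid

  +-congʳ : ∀ {x y} z → x ≡ₙ y → x + z ≡ₙ y + z
  +-congʳ {x} {y} z (modeq e) = modeq (begin
    (x + z) % N          ≡⟨ %-distribˡ-+ x z N ⟩
    (x % N + z % N) % N  ≡⟨ cong (λ w → (w + z % N) % N) e ⟩
    (y % N + z % N) % N  ≡⟨ %-distribˡ-+ y z N ⟨
    (y + z) % N          ∎)
    where open ≡-Reasoning

  +-congˡ : ∀ {x y} z → x ≡ₙ y → z + x ≡ₙ z + y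
  +-congˡ {x} {y} z e rewrite +-comm z x | +-comm z y = +-congʳ z e

  m+N≡ₙm : ∀ x → x + N ≡ₙ x
  m+N≡ₙm x = modeq ([m+n]%n≡m%n x N)

  <N⇒≡ₙ⇒≡ : ∀ {x y} → x < N → y < N → x ≡ₙ y → x ≡ y
  <N⇒≡ₙ⇒≡ x<N y<N (modeq e) = trans (sym (m<n⇒m%n≡m x<N)) (trans e (m<n⇒m%n≡m y<N))

  _≡ₙ?_ : ∀ x y → Dec (x ≡ₙ y)
  x ≡ₙ? y with x % N ≟ y % N
  ... | yes e = yes (modeq e)
  ... | no ¬e = no (¬e ∘ unmod)

  neg : ℕ → ℕ
  neg x = N ∸ x % N

  neg-inverseˡ : ∀ x → neg x + x ≡ₙ 0
  neg-inverseˡ x = modeq (begin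
    (neg x + x) % N                    ≡⟨ cong (λ w → (neg x + w) % N) (m≡m%n+[m/n]*n x N) ⟩
    (neg x + (x % N + x / N * N)) % N  ≡⟨ cong (_% N) (+-assoc (neg x) (x % N) _) ⟨
    (neg x + x % N + x / N * N) % N    ≡⟨ cong (λ w → (w + x / N * N) % N) (m∸n+n≡m (<⇒≤ (m%n<n x N))) ⟩
    (N + x / N * N) % N                ≡⟨ m*n%n≡0 (suc (x / N)) N ⟩
    0                                  ∎)
    where open ≡-Reasoning

  neg-inverseʳ : ∀ x → x + neg x ≡ₙ 0
  neg-inverseʳ x rewrite +-comm x (neg x) = neg-inverseˡ x

  +-cancelʳ : ∀ {x y} z → x + z ≡ₙ y + z → x ≡ₙ y
  +-cancelʳ {x} {y} z e = begin
    x                ≡⟨ +-identityʳ x ⟨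
    x + 0            ≈⟨ +-congˡ x (neg-inverseʳ z) ⟨
    x + (z + neg z)  ≡⟨ +-assoc x z (neg z) ⟨
    x + z + neg z    ≈⟨ +-congʳ (neg z) e ⟩
    y + z + neg z    ≡⟨ +-assoc y z (neg z) ⟩
    y + (z + neg z)  ≈⟨ +-congˡ y (neg-inverseʳ z) ⟩
    y + 0            ≡⟨ +-identityʳ y ⟩
    y                ∎
    where open ≡ₙ-Reasoning

  +-cancelˡ : ∀ {x y} z → z + x ≡ₙ z + y → x ≡ₙ y
  +-cancelˡ {x} {y} z e rewrite +-comm z x | +-comm z y = +-cancelʳ z e

  neg-involutive : ∀ x → neg (neg x) ≡ₙ x
  neg-involutive x = +-cancelʳ (neg x) (≡ₙ-trans (neg-inverseˡ (neg x)) (≡ₙ-sym (neg-inverseʳ x)))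

  neg-cong : ∀ {x y} → x ≡ₙ y → neg x ≡ₙ neg y
  neg-cong {x} {y} e = +-cancelʳ x (≡ₙ-trans (neg-inverseˡ x) (≡ₙ-sym (≡ₙ-trans (+-congˡ (neg y) e) (neg-inverseˡ y))))

  neg-injective : ∀ {x y} → neg x ≡ₙ neg y → x ≡ₙ y
  neg-injective {x} {y} e = ≡ₙ-trans (≡ₙ-sym (neg-involutive x)) (≡ₙ-trans (neg-cong e) (neg-involutive y))

  neg-flip : ∀ {x y} → neg x ≡ₙ y → x ≡ₙ neg y
  neg-flip {x} e = ≡ₙ-trans (≡ₙ-sym (neg-involutive x)) (neg-cong e)

  neg[m+n]+n≡ₙneg[m] : ∀ x t → neg (x + t) + t ≡ₙ neg x
  neg[m+n]+n≡ₙneg[m] x t = +-cancelʳ x (begin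
    neg (x + t) + t + x    ≡⟨ +-assoc (neg (x + t)) t x ⟩
    neg (x + t) + (t + x)  ≡⟨ cong (neg (x + t) +_) (+-comm t x) ⟩
    neg (x + t) + (x + t)  ≈⟨ neg-inverseˡ (x + t) ⟩
    0                      ≈⟨ neg-inverseˡ x ⟨
    neg x + x              ∎)
    where open ≡ₙ-Reasoning

  neg[m+l]+t≡ₙneg[m+[l∸t]] : ∀ x {t l} → t ≤ l → neg (x + l) + t ≡ₙ neg (x + (l ∸ t))
  neg[m+l]+t≡ₙneg[m+[l∸t]] x {t} {l} t≤l = begin
    neg (x + l) + t              ≡⟨ cong (λ w → neg (x + w) + t) (m∸n+n≡m t≤l) ⟨
    neg (x + (l ∸ t + t)) + t    ≡⟨ cong (λ w → neg w + t) (+-assoc x (l ∸ t) t) ⟨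
    neg (x + (l ∸ t) + t) + t    ≈⟨ neg[m+n]+n≡ₙneg[m] (x + (l ∸ t)) t ⟩
    neg (x + (l ∸ t))            ∎
    where open ≡ₙ-Reasoning

  +-cancelˡ-≡ₙ⇒≡ : ∀ {x t t'} → t < N → t' < N → x + t ≡ₙ x + t' → t ≡ t'
  +-cancelˡ-≡ₙ⇒≡ {x} t<N t'<N e = <N⇒≡ₙ⇒≡ t<N t'<N (+-cancelˡ x e)

SuccMod : ℕ → ℕ → ℕ → Set
SuccMod m y z = z ≡ suc y ⊎ (suc y ≡ m × z ≡ 0)

CyclicSucc : (m : ℕ) → Fin m → Fin m → Set
CyclicSucc m i j = SuccMod m (toℕ i) (toℕ j)

CyclicSucc? : ∀ m (i j : Fin m) → Dec (CyclicSucc m i j)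
CyclicSucc? m i j with toℕ j ≟ suc (toℕ i) | suc (toℕ i) ≟ m | toℕ j ≟ 0
... | yes p | _     | _     = yes (inj₁ p)
... | no ¬p | yes q | yes r = yes (inj₂ (q , r))
... | no ¬p | no ¬q | _     = no λ { (inj₁ p) → ¬p p ; (inj₂ (q , _)) → ¬q q }
... | no ¬p | yes _ | no ¬r = no λ { (inj₁ p) → ¬p p ; (inj₂ (_ , r)) → ¬r r }

cyclicSucc : ∀ {m} (k : Fin m) → ∃[ k⁺ ] CyclicSucc m k k⁺
cyclicSucc {suc m} k with suc (toℕ k) <? suc m
... | yes k+1<m = fromℕ< k+1<m , inj₁ (toℕ-fromℕ< k+1<m)
... | no  k+1≮m = fzero , inj₂ (≤-antisym (toℕ<n k) (≮⇒≥ k+1≮m) , refl)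

cyclicPred : ∀ {m} (k : Fin m) → ∃[ k⁻ ] CyclicSucc m k⁻ k
cyclicPred {suc m} k with toℕ k | toℕ<n k
... | zero  | _   = fromℕ< (n<1+n m) , inj₂ (cong suc (toℕ-fromℕ< (n<1+n m)) , refl)
... | suc y | k<m = fromℕ< y<m , inj₁ (cong suc (sym (toℕ-fromℕ< y<m)))
  where y<m = <-trans (n<1+n y) k<m

pattern 4+m≥4 = s≤s (s≤s (s≤s (s≤s _)))

succ≢pred : ∀ {m x y z} → 4 ≤ m → SuccMod m x y → SuccMod m z x → y ≢ z
succ≢pred 4+m≥4 (inj₁ refl) (inj₁ refl) e = <⇒≢ (m<n⇒m<1+n (n<1+n _)) (sym e)
succ≢pred 4+m≥4 (inj₁ refl) (inj₂ (() , refl)) refl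
succ≢pred 4+m≥4 (inj₂ (() , refl)) (inj₁ refl) refl
succ≢pred 4+m≥4 (inj₂ (_ , refl)) (inj₂ (() , refl)) refl

¬succ→pred : ∀ {m x y z} → 4 ≤ m → SuccMod m x y → SuccMod m z x → ¬ SuccMod m y z
¬succ→pred 4+m≥4 (inj₁ refl) (inj₁ refl) (inj₁ e) = <⇒≢ (m<n⇒m<1+n (m<n⇒m<1+n (n<1+n _))) e
¬succ→pred 4+m≥4 (inj₁ refl) (inj₁ refl) (inj₂ (() , refl))
¬succ→pred 4+m≥4 (inj₁ refl) (inj₂ (() , refl)) (inj₁ refl)
¬succ→pred 4+m≥4 (inj₁ refl) (inj₂ (_ , refl)) (inj₂ (() , _))
¬succ→pred 4+m≥4 (inj₂ (() , refl)) (inj₁ refl) (inj₁ refl)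
¬succ→pred 4+m≥4 (inj₂ (_ , refl)) (inj₁ refl) (inj₂ (() , _))
¬succ→pred 4+m≥4 (inj₂ (e , refl)) (inj₂ (_ , refl)) _ with () ← e

¬pred→succ : ∀ {m x y z} → 4 ≤ m → SuccMod m x y → SuccMod m z x → ¬ SuccMod m z y
¬pred→succ 4+m≥4 (inj₁ refl) (inj₁ refl) (inj₁ e) = 1+n≢n e
¬pred→succ 4+m≥4 (inj₁ refl) (inj₁ refl) (inj₂ (_ , ()))
¬pred→succ 4+m≥4 (inj₁ refl) (inj₂ (() , refl)) (inj₁ refl)
¬pred→succ 4+m≥4 (inj₁ refl) (inj₂ (_ , refl)) (inj₂ (_ , ()))
¬pred→succ 4+m≥4 (inj₂ (_ , refl)) (inj₁ refl) (inj₁ ())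
¬pred→succ 4+m≥4 (inj₂ (e , refl)) (inj₁ refl) (inj₂ (e' , _)) =
  1+n≢n (sym (suc-injective (trans e' (sym e))))
¬pred→succ 4+m≥4 (inj₂ (e , refl)) (inj₂ (_ , refl)) _ with () ← e

≤3⇒adjacent : ∀ {m} → m ≤ 3 → (i j : Fin m) → i ≢ j → CyclicSucc m i j ⊎ CyclicSucc m j i
≤3⇒adjacent _ fzero               fzero               i≢j = ⊥-elim (i≢j refl)
≤3⇒adjacent _ (fsuc fzero)        (fsuc fzero)        i≢j = ⊥-elim (i≢j refl)
≤3⇒adjacent _ (fsuc (fsuc fzero)) (fsuc (fsuc fzero)) i≢j = ⊥-elim (i≢j refl)
≤3⇒adjacent _ fzero               (fsuc fzero)        _   = inj₁ (inj₁ refl)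
≤3⇒adjacent _ (fsuc fzero)        fzero               _   = inj₂ (inj₁ refl)
≤3⇒adjacent _ (fsuc fzero)        (fsuc (fsuc fzero)) _   = inj₁ (inj₁ refl)
≤3⇒adjacent _ (fsuc (fsuc fzero)) (fsuc fzero)        _   = inj₂ (inj₁ refl)
≤3⇒adjacent (s≤s (s≤s (s≤s z≤n))) fzero (fsuc (fsuc fzero)) _ = inj₂ (inj₂ (refl , refl))
≤3⇒adjacent (s≤s (s≤s (s≤s z≤n))) (fsuc (fsuc fzero)) fzero _ = inj₁ (inj₂ (refl , refl))
≤3⇒adjacent (s≤s (s≤s (s≤s m≤0))) (fsuc (fsuc (fsuc k))) _ _ = ⊥-elim (n≮0 (<-≤-trans (toℕ<n k) m≤0))
≤3⇒adjacent (s≤s (s≤s (s≤s m≤0))) _ (fsuc (fsuc (fsuc k))) _ = ⊥-elim (n≮0 (<-≤-trans (toℕ<n k) m≤0))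

Fin-argmax : ∀ {a r} {A : Set a} (_≤_ : Rel A r) → Reflexive _≤_ → Transitive _≤_ → Total _≤_ →
             ∀ {n} → Fin n → (f : Fin n → A) → ∃[ k ] ∀ j → f j ≤ f k
Fin-argmax _≤_ ≤-refl′ ≤-trans′ ≤-total′ {1} _ f = fzero , λ { fzero → ≤-refl′ }
Fin-argmax _≤_ ≤-refl′ ≤-trans′ ≤-total′ {suc (suc n)} _ f
  with Fin-argmax _≤_ ≤-refl′ ≤-trans′ ≤-total′ fzero (f ∘ fsuc)
... | k , max with ≤-total′ (f fzero) (f (fsuc k))
...   | inj₁ f0≤fk = fsuc k , λ { fzero → f0≤fk ; (fsuc j) → max j }
...   | inj₂ fk≤f0 = fzero  , λ { fzero → ≤-refl′ ; (fsuc j) → ≤-trans′ (max j) fk≤f0 }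

incident-edge : ∀ {L} → 1 ≤ L → (r : Fin (suc L)) → ∃[ k ] (inject₁ k ≡ r ⊎ fsuc k ≡ r)
incident-edge {suc L} _ r with toℕ r <? suc L
... | yes r<L = fromℕ< r<L , inj₁ (toℕ-injective (trans (toℕ-inject₁ _) (toℕ-fromℕ< r<L)))
... | no  r≮L = fromℕ< (n<1+n L) , inj₂ (toℕ-injective (trans (cong suc (toℕ-fromℕ< (n<1+n L)))
                                      (sym (≤-antisym (≤-pred (toℕ<n r)) (≮⇒≥ r≮L)))))

<⇒pred< : ∀ {x n} → x < n → pred n < n
<⇒pred< (s≤s _) = ≤-refl

-- Arcs of the cycle ℤ/N: arc i has the vertices origin i + t (t ≤ len i) and
-- the edges e = origin i + u (u < len i), where edge e is {e, e + 1}.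
module CycleArcs (n s m : ℕ) where
  open Modular n

  Adjacent : Fin m → Fin m → Set
  Adjacent i j = CyclicSucc m i j ⊎ CyclicSucc m j i

  record ArcSystem : Set where
    constructor arcs
    field origin len : Fin m → ℕ

  module _ (A : ArcSystem) where
    open ArcSystem A

    At : Fin m → ℕ → ℕ → Set
    At i t q = t ≤ len i × origin i + t ≡ₙ q

    OnArc : Fin m → ℕ → Set
    OnArc i q = ∃[ t ] At i t q

    EdgeOnArc : Fin m → ℕ → Set
    EdgeOnArc i e = ∃[ u ] u < len i × origin i + u ≡ₙ e

    OnArc-resp : ∀ {i q q'} → OnArc i q → q ≡ₙ q' → OnArc i q'
    OnArc-resp (t , t≤ , e) q≡q' = t , t≤ , ≡ₙ-trans e q≡q'

    EdgeOnArc-resp : ∀ {i e e'} → EdgeOnArc i e → e ≡ₙ e' → EdgeOnArc i e'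
    EdgeOnArc-resp (u , u< , e) e≡e' = u , u< , ≡ₙ-trans e e≡e'

    -- The combinatorial trace of an s-geodesic covering by arcs indexed
    -- cyclically: arcs are at most half the cycle, they cover every edge,
    -- non-adjacent arcs are edge-disjoint, and adjacent arcs overlap in a
    -- segment with at least 2s + 1 vertices.
    record Covering : Set where
      field
        len+len≤N : ∀ i → len i + len i ≤ N
        len≥1     : ∀ i → 1 ≤ len i
        covers    : ∀ e → ∃[ i ] EdgeOnArc i e
        disjoint  : ∀ i j → i ≢ j → ¬ CyclicSucc m i j → ¬ CyclicSucc m j i →
                    ∀ e → EdgeOnArc i e → EdgeOnArc j e → ⊥
        shared-vertex-on-shared-edge : ∀ i j → Adjacent i j → ∀ q → OnArc i q → OnArc j q →
                    ∃[ e ] EdgeOnArc i e × EdgeOnArc j e × (e ≡ₙ q ⊎ e + 1 ≡ₙ q)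
        shared-vertices : ∀ i j → Adjacent i j →
                    Σ (Fin (suc (2 * s)) → ℕ) λ f →
                      (∀ r r' → f r ≡ₙ f r' → r ≡ r') × (∀ r → OnArc i (f r) × OnArc j (f r))

  -- Reflecting the cycle (q ↦ -q) exchanges the two ends of every arc.
  mirror : ArcSystem → ArcSystem
  mirror A = arcs (λ i → neg (origin i + len i)) len
    where open ArcSystem A

  module _ (A : ArcSystem) where
    open ArcSystem A

    At-mirror⁻ : ∀ {i t q} → At (mirror A) i t q → At A i (len i ∸ t) (neg q)
    At-mirror⁻ {i} {t} {q} (t≤ , e) = m∸n≤m (len i) t ,
      neg-flip (≡ₙ-trans (≡ₙ-sym (neg[m+l]+t≡ₙneg[m+[l∸t]] (origin i) t≤)) e)

    At-mirror⁺ : ∀ {i t q} → At A i t (neg q) → At (mirror A) i (len i ∸ t) q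
    At-mirror⁺ {i} {t} {q} (t≤ , e) = m∸n≤m (len i) t , (begin
      neg (origin i + len i) + (len i ∸ t)  ≈⟨ neg[m+l]+t≡ₙneg[m+[l∸t]] (origin i) (m∸n≤m (len i) t) ⟩
      neg (origin i + (len i ∸ (len i ∸ t))) ≡⟨ cong (λ w → neg (origin i + w)) (m∸[m∸n]≡n t≤) ⟩
      neg (origin i + t)                    ≈⟨ neg-cong e ⟩
      neg (neg q)                          ≈⟨ neg-involutive q ⟩
      q                                    ∎)
      where open ≡ₙ-Reasoning

    EdgeOnArc-mirror⁻ : ∀ {i e} → EdgeOnArc (mirror A) i e → EdgeOnArc A i (neg (e + 1))
    EdgeOnArc-mirror⁻ {i} {e} (u , u< , eq) = len i ∸ suc u , ∸-monoʳ-< (s≤s z≤n) u< ,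
      neg-flip (begin
        neg (origin i + (len i ∸ suc u))  ≈⟨ neg[m+l]+t≡ₙneg[m+[l∸t]] (origin i) u< ⟨
        neg (origin i + len i) + suc u    ≡⟨ +-suc _ u ⟩
        suc (neg (origin i + len i) + u)  ≡⟨ +-comm 1 _ ⟩
        neg (origin i + len i) + u + 1    ≈⟨ +-congʳ 1 eq ⟩
        e + 1                            ∎)
      where open ≡ₙ-Reasoning

    EdgeOnArc-mirror⁺ : ∀ {i e} → EdgeOnArc A i (neg (e + 1)) → EdgeOnArc (mirror A) i e
    EdgeOnArc-mirror⁺ {i} {e} (u , u< , eq) = len i ∸ suc u , ∸-monoʳ-< (s≤s z≤n) u< ,
      +-cancelʳ 1 (begin
        neg (origin i + len i) + (len i ∸ suc u) + 1  ≡⟨ +-comm _ 1 ⟩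
        suc (neg (origin i + len i) + (len i ∸ suc u))
          ≈⟨ +-congˡ 1 (neg[m+l]+t≡ₙneg[m+[l∸t]] (origin i) (m∸n≤m (len i) (suc u))) ⟩
        suc (neg (origin i + (len i ∸ (len i ∸ suc u))))
          ≡⟨ cong (λ w → suc (neg (origin i + w))) (m∸[m∸n]≡n u<) ⟩
        suc (neg (origin i + suc u))                  ≡⟨ cong (λ w → suc (neg w)) (+-suc (origin i) u) ⟩
        suc (neg (suc (origin i + u)))                ≡⟨ +-comm 1 _ ⟩
        neg (suc (origin i + u)) + 1                  ≡⟨ cong (λ w → neg w + 1) (+-comm 1 _) ⟩
        neg (origin i + u + 1) + 1                    ≈⟨ neg[m+n]+n≡ₙneg[m] (origin i + u) 1 ⟩
        neg (origin i + u)                            ≈⟨ neg-cong eq ⟩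
        neg (neg (e + 1))                            ≈⟨ neg-involutive (e + 1) ⟩
        e + 1                                        ∎)
      where open ≡ₙ-Reasoning

    mirror-covering : Covering A → Covering (mirror A)
    mirror-covering C = record
      { len+len≤N = len+len≤N
      ; len≥1     = len≥1
      ; covers    = λ e → map₂ EdgeOnArc-mirror⁺ (covers (neg (e + 1)))
      ; disjoint  = λ i j i≢j ¬ij ¬ji e onᵢ onⱼ →
          disjoint i j i≢j ¬ij ¬ji _ (EdgeOnArc-mirror⁻ onᵢ) (EdgeOnArc-mirror⁻ onⱼ)
      ; shared-vertex-on-shared-edge = shared-edge′
      ; shared-vertices = shared-vertices′ }
      where
        open Covering C

        mirror-edge : ∀ e → e ≡ₙ neg (neg (e + 1) + 1)
        mirror-edge e = ≡ₙ-trans (≡ₙ-sym (neg-involutive e)) (neg-cong (≡ₙ-sym (neg[m+n]+n≡ₙneg[m] e 1)))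

        mirror-edge-on : ∀ {i e} → EdgeOnArc A i e → EdgeOnArc (mirror A) i (neg (e + 1))
        mirror-edge-on {e = e} on = EdgeOnArc-mirror⁺ (EdgeOnArc-resp A on (mirror-edge e))

        mirror-incidence : ∀ {e q} → e ≡ₙ neg q ⊎ e + 1 ≡ₙ neg q →
                           neg (e + 1) ≡ₙ q ⊎ neg (e + 1) + 1 ≡ₙ q
        mirror-incidence {e} {q} (inj₁ e≡-q) =
          inj₂ (≡ₙ-trans (neg[m+n]+n≡ₙneg[m] e 1) (≡ₙ-trans (neg-cong e≡-q) (neg-involutive q)))
        mirror-incidence {e} {q} (inj₂ e+1≡-q) = inj₁ (≡ₙ-trans (neg-cong e+1≡-q) (neg-involutive q))

        shared-edge′ : ∀ i j → Adjacent i j → ∀ q → OnArc (mirror A) i q → OnArc (mirror A) j q →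
                       ∃[ e ] EdgeOnArc (mirror A) i e × EdgeOnArc (mirror A) j e × (e ≡ₙ q ⊎ e + 1 ≡ₙ q)
        shared-edge′ i j adj q onᵢ onⱼ
          with shared-vertex-on-shared-edge i j adj (neg q) (_ , At-mirror⁻ (proj₂ onᵢ)) (_ , At-mirror⁻ (proj₂ onⱼ))
        ... | e , eᵢ , eⱼ , incident = neg (e + 1) , mirror-edge-on eᵢ , mirror-edge-on eⱼ , mirror-incidence incident

        mirror-vertex-on : ∀ {i q} → OnArc A i q → OnArc (mirror A) i (neg q)
        mirror-vertex-on {q = q} on = _ , At-mirror⁺ (proj₂ (OnArc-resp A on (≡ₙ-sym (neg-involutive q))))

        shared-vertices′ : ∀ i j → Adjacent i j →
                           Σ (Fin (suc (2 * s)) → ℕ) λ f →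
                             (∀ r r' → f r ≡ₙ f r' → r ≡ r') ×
                             (∀ r → OnArc (mirror A) i (f r) × OnArc (mirror A) j (f r))
        shared-vertices′ i j adj with shared-vertices i j adj
        ... | f , f-inj , f-on = neg ∘ f , (λ r r' e → f-inj r r' (neg-injective e)) ,
                                 λ r → map mirror-vertex-on mirror-vertex-on (f-on r)

  module _ {A : ArcSystem} (C : Covering A) where
    open ArcSystem A
    open Covering C

    len<N : ∀ i → len i < N
    len<N i = <-≤-trans (m<m+n (len i) (len≥1 i)) (len+len≤N i)

    len[i]+len[j]≤N : ∀ i j → len i + len j ≤ N
    len[i]+len[j]≤N i j with ≤-total (len i) (len j)
    ... | inj₁ i≤j = ≤-trans (+-monoˡ-≤ (len j) i≤j) (len+len≤N j)
    ... | inj₂ j≤i = ≤-trans (+-monoʳ-≤ (len i) j≤i) (len+len≤N i)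

    adjacent-share-edge : ∀ i j → Adjacent i j → ∃[ e ] EdgeOnArc A i e × EdgeOnArc A j e
    adjacent-share-edge i j adj with shared-vertices i j adj
    ... | f , _ , f-on with f-on fzero
    ... | onᵢ , onⱼ with shared-vertex-on-shared-edge i j adj (f fzero) onᵢ onⱼ
    ... | e , eᵢ , eⱼ , _ = e , eᵢ , eⱼ

    Interior : ℕ → Set
    Interior b = ∃₂ λ j τ → 1 ≤ τ × τ < len j × origin j + τ ≡ₙ b

    Interior? : ∀ b → Dec (Interior b)
    Interior? b = map′ fromFin toFin
      (any? λ j → any? λ (k : Fin (len j)) → (1 ≤? toℕ k) ×-dec (origin j + toℕ k ≡ₙ? b))
      where
        fromFin : (∃₂ λ j (k : Fin (len j)) → 1 ≤ toℕ k × origin j + toℕ k ≡ₙ b) → Interior b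
        fromFin (j , k , 1≤k , at) = j , toℕ k , 1≤k , toℕ<n k , at
        toFin : Interior b → ∃₂ λ j (k : Fin (len j)) → 1 ≤ toℕ k × origin j + toℕ k ≡ₙ b
        toFin (j , τ , 1≤τ , τ< , at) = j , fromℕ< τ< ,
          subst (λ x → 1 ≤ x × origin j + x ≡ₙ b) (sym (toℕ-fromℕ< τ<)) (1≤τ , at)

    -- Cutting the cycle open at a vertex b interior to no arc turns every arc
    -- into an interval [lo j, hi j] of [0, N].
    module CutAt (b : ℕ) (¬int : ¬ Interior b) where

      lo : Fin m → ℕ
      lo j = (origin j + neg b) % N

      hi : Fin m → ℕ
      hi j = lo j + len j

      lo<N : ∀ j → lo j < N
      lo<N j = m%n<n (origin j + neg b) N

      b+lo≡ₙorigin : ∀ j → b + lo j ≡ₙ origin j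
      b+lo≡ₙorigin j = begin
        b + lo j                ≈⟨ +-congˡ b (modeq (m%n%n≡m%n (origin j + neg b) N)) ⟩
        b + (origin j + neg b)  ≡⟨ +-assoc b (origin j) (neg b) ⟨
        b + origin j + neg b    ≡⟨ cong (_+ neg b) (+-comm b (origin j)) ⟩
        origin j + b + neg b    ≡⟨ +-assoc (origin j) b (neg b) ⟩
        origin j + (b + neg b)  ≈⟨ +-congˡ (origin j) (neg-inverseʳ b) ⟩
        origin j + 0            ≡⟨ +-identityʳ (origin j) ⟩
        origin j                ∎
        where open ≡ₙ-Reasoning

      hi≤N : ∀ j → hi j ≤ N
      hi≤N j with hi j ≤? N
      ... | yes hi≤N = hi≤N
      ... | no  hi≰N = ⊥-elim (¬int (j , N ∸ lo j , m<n⇒0<n∸m (lo<N j) , N∸lo<len , wraps-to-b))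
        where
          N∸lo<len : N ∸ lo j < len j
          N∸lo<len = +-cancelˡ-< (lo j) _ _
            (subst (_< hi j) (sym (m+[n∸m]≡n (<⇒≤ (lo<N j)))) (≰⇒> hi≰N))
          wraps-to-b : origin j + (N ∸ lo j) ≡ₙ b
          wraps-to-b = begin
            origin j + (N ∸ lo j)       ≈⟨ +-congʳ (N ∸ lo j) (b+lo≡ₙorigin j) ⟨
            b + lo j + (N ∸ lo j)       ≡⟨ +-assoc b (lo j) (N ∸ lo j) ⟩
            b + (lo j + (N ∸ lo j))     ≡⟨ cong (b +_) (m+[n∸m]≡n (<⇒≤ (lo<N j))) ⟩
            b + N                       ≈⟨ m+N≡ₙm b ⟩
            b                           ∎
            where open ≡ₙ-Reasoning

      edge-position : ∀ {j e} → EdgeOnArc A j e → ∃[ x ] lo j ≤ x × x < hi j × b + x ≡ₙ e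
      edge-position {j} (u , u<len , at) = lo j + u , m≤m+n (lo j) u , +-monoʳ-< (lo j) u<len ,
        ≡ₙ-trans (≡⇒≡ₙ (sym (+-assoc b (lo j) u))) (≡ₙ-trans (+-congʳ u (b+lo≡ₙorigin j)) at)

      edge-at-position : ∀ {j x} → lo j ≤ x → x < hi j → EdgeOnArc A j (b + x)
      edge-at-position {j} {x} lo≤x x<hi = x ∸ lo j ,
        +-cancelˡ-< (lo j) _ _ (subst (_< hi j) (sym (m+[n∸m]≡n lo≤x)) x<hi) ,
        ≡ₙ-trans (+-congʳ (x ∸ lo j) (≡ₙ-sym (b+lo≡ₙorigin j)))
                 (≡⇒≡ₙ (trans (+-assoc b (lo j) (x ∸ lo j)) (cong (b +_) (m+[n∸m]≡n lo≤x))))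

      -- The arc k ending first shares an edge with each neighbour; on the cut
      -- line that edge lies before hi k, so both neighbours contain the last
      -- edge of k, although (for m ≥ 4) they are disjoint.
      ends-first-contradiction : 4 ≤ m → Fin m → ⊥
      ends-first-contradiction 4≤m i =
        disjoint k⁺ k⁻ k⁺≢k⁻ (¬succ→pred 4≤m k→k⁺ k⁻→k) (¬pred→succ 4≤m k→k⁺ k⁻→k) _
                       (last-edge-of-k k⁺ (inj₁ k→k⁺)) (last-edge-of-k k⁻ (inj₂ k⁻→k))
        where
          first-end = Fin-argmax _≥_ ≤-refl (λ p q → ≤-trans q p) (λ x y → ≤-total y x) i hi
          k = proj₁ first-end
          k⁺ = proj₁ (cyclicSucc k)
          k→k⁺ = proj₂ (cyclicSucc k)
          k⁻ = proj₁ (cyclicPred k)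
          k⁻→k = proj₂ (cyclicPred k)

          k⁺≢k⁻ : k⁺ ≢ k⁻
          k⁺≢k⁻ e = succ≢pred 4≤m k→k⁺ k⁻→k (cong toℕ e)

          last-edge-of-k : ∀ j → Adjacent k j → EdgeOnArc A j (b + pred (hi k))
          last-edge-of-k j adj with adjacent-share-edge k j adj
          ... | e , eₖ , eⱼ with edge-position eₖ | edge-position eⱼ
          ... | x , _ , x<hiₖ , bx≡e | x' , lo≤x' , x'<hiⱼ , bx'≡e = edge-at-position lo≤last last<hi
            where
              x≡x' : x ≡ x'
              x≡x' = +-cancelˡ-≡ₙ⇒≡ (<-≤-trans x<hiₖ (hi≤N k)) (<-≤-trans x'<hiⱼ (hi≤N j))
                                   (≡ₙ-trans bx≡e (≡ₙ-sym bx'≡e))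
              lo≤last : lo j ≤ pred (hi k)
              lo≤last = ≤-trans lo≤x' (subst (_≤ pred (hi k)) x≡x' (<⇒≤pred x<hiₖ))
              last<hi : pred (hi k) < hi j
              last<hi = <-≤-trans (<⇒pred< x<hiₖ) (proj₂ first-end j)

    ¬end-at-offset<len : ∀ {i τ} → τ < len i → origin i + τ ≡ₙ origin i + len i → ⊥
    ¬end-at-offset<len {i} τ<len at =
      <-irrefl (+-cancelˡ-≡ₙ⇒≡ (<-trans τ<len (len<N i)) (len<N i) at) τ<len

    few-arcs-endpoint-interior : m ≤ 3 → ∀ i → Interior (origin i + len i)
    few-arcs-endpoint-interior m≤3 i with covers (origin i + len i)
    ... | j , u , u<len , at = j , u , 1≤u , u<len , at
      where
        i≢j : i ≢ j
        i≢j refl = ¬end-at-offset<len u<len at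

        1≤u : 1 ≤ u
        1≤u with shared-vertex-on-shared-edge i j (≤3⇒adjacent m≤3 i j i≢j) _
                   (len i , ≤-refl , ≡ₙ-refl) (u , <⇒≤ u<len , at)
        ... | e , (u₁ , u₁<len , atᵢ) , _ , inj₁ e≡end = ⊥-elim (¬end-at-offset<len u₁<len (≡ₙ-trans atᵢ e≡end))
        ... | e , _ , (u₂ , u₂<len , atⱼ) , inj₂ e+1≡end = subst (1 ≤_) u₂+1≡u (s≤s z≤n)
          where
            u₂+1≡u : suc u₂ ≡ u
            u₂+1≡u = +-cancelˡ-≡ₙ⇒≡ (≤-<-trans u₂<len (len<N j)) (<-trans u<len (len<N j))
              (≡ₙ-trans (≡⇒≡ₙ (trans (+-suc (origin j) u₂) (+-comm 1 _)))
                (≡ₙ-trans (+-congʳ 1 atⱼ) (≡ₙ-trans e+1≡end (≡ₙ-sym at))))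

    endpoint-interior : ∀ i → Interior (origin i + len i)
    endpoint-interior i with m ≤? 3
    ... | yes m≤3 = few-arcs-endpoint-interior m≤3 i
    ... | no  m≰3 = decidable-stable (Interior? _) λ ¬int → CutAt.ends-first-contradiction _ ¬int (≰⇒> m≰3) i

    module EndInside {i j τ} (1≤τ : 1 ≤ τ) (τ<len : τ < len j) (end : origin j + τ ≡ₙ origin i + len i) where

      i≢j : i ≢ j
      i≢j refl = ¬end-at-offset<len τ<len end

      last-edge-in-j : EdgeOnArc A j (origin i + (len i ∸ 1))
      last-edge-in-j = τ ∸ 1 , ≤-<-trans (m∸n≤m τ 1) τ<len , +-cancelʳ 1 (begin
        origin j + (τ ∸ 1) + 1       ≡⟨ +-assoc (origin j) (τ ∸ 1) 1 ⟩
        origin j + (τ ∸ 1 + 1)       ≡⟨ cong (origin j +_) (m∸n+n≡m 1≤τ) ⟩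
        origin j + τ                 ≈⟨ end ⟩
        origin i + len i             ≡⟨ cong (origin i +_) (m∸n+n≡m (len≥1 i)) ⟨
        origin i + (len i ∸ 1 + 1)   ≡⟨ +-assoc (origin i) (len i ∸ 1) 1 ⟨
        origin i + (len i ∸ 1) + 1   ∎)
        where open ≡ₙ-Reasoning

      adjacent : Adjacent i j
      adjacent with CyclicSucc? m i j | CyclicSucc? m j i
      ... | yes i→j | _       = inj₁ i→j
      ... | no _    | yes j→i = inj₂ j→i
      ... | no ¬i→j | no ¬j→i = ⊥-elim (disjoint i j i≢j ¬i→j ¬j→i _
                                  (len i ∸ 1 , ∸-monoʳ-< (s≤s z≤n) (len≥1 i) , ≡ₙ-refl) last-edge-in-j)

      -- Past offset τ, arc j runs beyond the end of arc i, and the two arcs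
      -- are too short together to meet again.
      shared-offset≤τ : ∀ {q t₁ t₂} → At A i t₁ q → At A j t₂ q → t₂ ≤ τ
      shared-offset≤τ {q} {t₁} {t₂} (t₁≤len , atᵢ) (t₂≤len , atⱼ) with t₂ ≤? τ
      ... | yes t₂≤τ = t₂≤τ
      ... | no  t₂≰τ = ⊥-elim (<-irrefl t₁≡len+w (≤-<-trans t₁≤len (m<m+n (len i) 1≤w)))
        where
          w = t₂ ∸ τ
          1≤w : 1 ≤ w
          1≤w = m<n⇒0<n∸m (≰⇒> t₂≰τ)
          τ+w≡t₂ : τ + w ≡ t₂
          τ+w≡t₂ = m+[n∸m]≡n (<⇒≤ (≰⇒> t₂≰τ))
          w<len : w < len j
          w<len = <-≤-trans (∸-monoʳ-< 1≤τ (<⇒≤ (≰⇒> t₂≰τ))) t₂≤len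
          t₁≡len+w : t₁ ≡ len i + w
          t₁≡len+w = +-cancelˡ-≡ₙ⇒≡ (≤-<-trans t₁≤len (len<N i))
            (<-≤-trans (+-monoʳ-< (len i) w<len) (len[i]+len[j]≤N i j)) (begin
              origin i + t₁          ≈⟨ atᵢ ⟩
              q                      ≈⟨ atⱼ ⟨
              origin j + t₂          ≡⟨ cong (origin j +_) τ+w≡t₂ ⟨
              origin j + (τ + w)     ≡⟨ +-assoc (origin j) τ w ⟨
              origin j + τ + w       ≈⟨ +-congʳ w end ⟩
              origin i + len i + w   ≡⟨ +-assoc (origin i) (len i) w ⟩
              origin i + (len i + w) ∎)
            where open ≡ₙ-Reasoning

      2s≤τ : 2 * s ≤ τ
      2s≤τ with shared-vertices i j adjacent
      ... | f , f-inj , f-on = ≤-pred (injective⇒≤ {f = λ r → fromℕ< (s≤s (bound r))} injective)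
        where
          offsetⱼ : Fin (suc (2 * s)) → ℕ
          offsetⱼ r = proj₁ (proj₂ (f-on r))
          atⱼ : ∀ r → At A j (offsetⱼ r) (f r)
          atⱼ r = proj₂ (proj₂ (f-on r))
          bound : ∀ r → offsetⱼ r ≤ τ
          bound r = shared-offset≤τ (proj₂ (proj₁ (f-on r))) (atⱼ r)
          injective : ∀ {r r'} → fromℕ< (s≤s (bound r)) ≡ fromℕ< (s≤s (bound r')) → r ≡ r'
          injective {r} {r'} e = f-inj r r' (begin
            f r                         ≈⟨ proj₂ (atⱼ r) ⟨
            origin j + offsetⱼ r        ≡⟨ cong (origin j +_) offsets≡ ⟩
            origin j + offsetⱼ r'       ≈⟨ proj₂ (atⱼ r') ⟩
            f r'                        ∎)
            where
              open ≡ₙ-Reasoning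
              offsets≡ = trans (sym (toℕ-fromℕ< (s≤s (bound r)))) (trans (cong toℕ e) (toℕ-fromℕ< (s≤s (bound r'))))

    -- The arc j passing through the end of arc i overlaps i in at least 2s
    -- edges just before that end, so a vertex p within s of the end of i lies
    -- at depth ≥ s in j, with more room after it than in i.
    more-room-after : ∀ {p i t} → At A i t p → len i ∸ t < s →
                      ∃₂ λ j t' → At A j t' p × s ≤ t' × len i ∸ t < len j ∸ t'
    more-room-after {p} {i} {t} (t≤len , at) room<s with endpoint-interior i
    ... | j , τ , 1≤τ , τ<len , end = j , τ ∸ d , (≤-trans (m∸n≤m τ d) (<⇒≤ τ<len) , at′) , s≤τ∸d , room′
      where
        open EndInside 1≤τ τ<len end
        d = len i ∸ t
        s+d≤τ : s + d ≤ τ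
        s+d≤τ = ≤-trans (+-monoʳ-≤ s (<⇒≤ room<s)) (≤-trans (≤-reflexive (cong (s +_) (sym (+-identityʳ s)))) 2s≤τ)
        d≤τ : d ≤ τ
        d≤τ = ≤-trans (m≤n+m d s) s+d≤τ
        s≤τ∸d : s ≤ τ ∸ d
        s≤τ∸d = m+n≤o⇒m≤o∸n s s+d≤τ
        room′ : d < len j ∸ (τ ∸ d)
        room′ = m+n≤o⇒m≤o∸n (suc d) (subst (_≤ len j) (cong suc (sym (m+[n∸m]≡n d≤τ))) τ<len)
        at′ : origin j + (τ ∸ d) ≡ₙ p
        at′ = +-cancelʳ d (begin
          origin j + (τ ∸ d) + d   ≡⟨ +-assoc (origin j) (τ ∸ d) d ⟩
          origin j + (τ ∸ d + d)   ≡⟨ cong (origin j +_) (m∸n+n≡m d≤τ) ⟩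
          origin j + τ             ≈⟨ end ⟩
          origin i + len i         ≡⟨ cong (origin i +_) (m+[n∸m]≡n t≤len) ⟨
          origin i + (t + d)       ≡⟨ +-assoc (origin i) t d ⟨
          origin i + t + d         ≈⟨ +-congʳ d at ⟩
          p + d                    ∎)
          where open ≡ₙ-Reasoning

  module _ {A : ArcSystem} (C : Covering A) where
    open ArcSystem A
    open Covering C

    more-room-before : ∀ {p i t} → At A i t p → t < s →
                       ∃₂ λ j t' → At A j t' p × s ≤ len j ∸ t' × t < t'
    more-room-before {p} {i} {t} (t≤len , at) t<s =
      from-mirror (more-room-after (mirror-covering A C) {neg p} {i} {len i ∸ t}
                    (At-mirror⁺ A (t≤len , ≡ₙ-trans at (≡ₙ-sym (neg-involutive p))))
                    (subst (_< s) (sym (m∸[m∸n]≡n t≤len)) t<s))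
      where
        from-mirror : (∃₂ λ j t̃ → At (mirror A) j t̃ (neg p) × s ≤ t̃ × len i ∸ (len i ∸ t) < len j ∸ t̃) →
                      ∃₂ λ j t' → At A j t' p × s ≤ len j ∸ t' × t < t'
        from-mirror (j , t̃ , at̃ , s≤t̃ , more) =
          j , len j ∸ t̃ , (proj₁ at′ , ≡ₙ-trans (proj₂ at′) (neg-involutive p)) ,
          subst (s ≤_) (sym (m∸[m∸n]≡n (proj₁ at̃))) s≤t̃ , subst (_< len j ∸ t̃) (m∸[m∸n]≡n t≤len) more
          where at′ = At-mirror⁻ A at̃

    room-after : ∀ k {p i t} → At A i t p → s ≤ len i ∸ t + k →
                 ∃₂ λ j t' → At A j t' p × s ≤ len j ∸ t'
    room-after zero {i = i} {t} at s≤room = i , t , at , subst (s ≤_) (+-identityʳ _) s≤room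
    room-after (suc k) {i = i} {t} at s≤room+k = case s ≤? len i ∸ t of λ where
      (yes s≤room) → i , t , at , s≤room
      (no  s≰room) → let j , t' , at' , _ , more = more-room-after C at (≰⇒> s≰room)
                     in room-after k at' (≤-trans s≤room+k (≤-trans (≤-reflexive (+-suc _ k)) (+-monoˡ-≤ k more)))

    Deep : ℕ → Set
    Deep p = ∃₂ λ j t → At A j t p × s ≤ t × s ≤ len j ∸ t

    room-before : ∀ k {p i t} → At A i t p → s ≤ len i ∸ t → s ≤ t + k → Deep p
    room-before zero {i = i} {t} at s≤after s≤t = i , t , at , subst (s ≤_) (+-identityʳ _) s≤t , s≤after
    room-before (suc k) {i = i} {t} at s≤after s≤t+k = case s ≤? t of λ where
      (yes s≤t) → i , t , at , s≤t , s≤after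
      (no  s≰t) → let j , t' , at' , s≤after′ , more = more-room-before at (≰⇒> s≰t)
                  in room-before k at' s≤after′ (≤-trans s≤t+k (≤-trans (≤-reflexive (+-suc t k)) (+-monoˡ-≤ k more)))

    deep : ∀ p → Deep p
    deep p =
      let i , u , u<len , at = covers p
          j , t , at′ , s≤after = room-after s (<⇒≤ u<len , at) (m≤n+m s _)
      in room-before s at′ s≤after (m≤n+m s t)

module IndexedWalks (G : Graph) where
  open Graph G

  infix  4 _⇝[_]_
  infixr 5 _∷_ _++_
  data _⇝[_]_ : V → ℕ → V → Set where
    []  : ∀ {x} → x ⇝[ 0 ] x
    _∷_ : ∀ {x y z n} → x ~ y → y ⇝[ n ] z → x ⇝[ suc n ] z

  fromVertices : ∀ n (f : Fin (suc n) → V) → (∀ k → f (inject₁ k) ~ f (fsuc k)) →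
                 f fzero ⇝[ n ] f (fromℕ n)
  fromVertices zero    f adj = []
  fromVertices (suc n) f adj = adj fzero ∷ fromVertices n (f ∘ fsuc) (adj ∘ fsuc)

  fromWalk : ∀ {x y} (W : Walk G) → start G W ≡ x → end G W ≡ y → x ⇝[ Walk.len W ] y
  fromWalk W refl refl = fromVertices (Walk.len W) (Walk.vtx W) (Walk.adj W)

  vertex : ∀ {x y n} → x ⇝[ n ] y → Fin (suc n) → V
  vertex ([] {x}) _            = x
  vertex (_∷_ {x} _ _) fzero   = x
  vertex (_ ∷ w)       (fsuc k) = vertex w k

  vertex-first : ∀ {x y n} (w : x ⇝[ n ] y) → vertex w fzero ≡ x
  vertex-first []      = refl
  vertex-first (_ ∷ _) = refl

  vertex-last : ∀ {x y n} (w : x ⇝[ n ] y) → vertex w (fromℕ n) ≡ y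
  vertex-last []      = refl
  vertex-last (_ ∷ w) = vertex-last w

  vertex-adj : ∀ {x y n} (w : x ⇝[ n ] y) → ∀ k → vertex w (inject₁ k) ~ vertex w (fsuc k)
  vertex-adj (x~y ∷ w) fzero    = subst (_ ~_) (sym (vertex-first w)) x~y
  vertex-adj (_   ∷ w) (fsuc k) = vertex-adj w k

  toWalk : ∀ {x y n} → x ⇝[ n ] y → Walk G
  toWalk {n = n} w = record { len = n ; vtx = vertex w ; adj = vertex-adj w }

  _++_ : ∀ {x y z n k} → x ⇝[ n ] y → y ⇝[ k ] z → x ⇝[ n + k ] z
  []      ++ w' = w'
  (e ∷ w) ++ w' = e ∷ (w ++ w')

  _∷ʳ_ : ∀ {x y z n} → x ⇝[ n ] y → y ~ z → x ⇝[ suc n ] z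
  []      ∷ʳ e = e ∷ []
  (e′ ∷ w) ∷ʳ e = e′ ∷ (w ∷ʳ e)

  reverse : ∀ {x y n} → x ⇝[ n ] y → y ⇝[ n ] x
  reverse []      = []
  reverse (e ∷ w) = reverse w ∷ʳ ~-sym e

  data All (Q : V → Set) : ∀ {x y n} → x ⇝[ n ] y → Set where
    [_] : ∀ {x} → Q x → All Q ([] {x})
    _∷_ : ∀ {x y z n} {e : x ~ y} {w : y ⇝[ n ] z} → Q x → All Q w → All Q (e ∷ w)

  All-vertex : ∀ {Q x y n} {w : x ⇝[ n ] y} → All Q w → ∀ k → Q (vertex w k)
  All-vertex [ q ]    _        = q
  All-vertex (q ∷ _)  fzero    = q
  All-vertex (_ ∷ qs) (fsuc k) = All-vertex qs k

  All-map : ∀ {Q R : V → Set} → (∀ {v} → Q v → R v) → ∀ {x y n} {w : x ⇝[ n ] y} → All Q w → All R w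
  All-map f [ q ]    = [ f q ]
  All-map f (q ∷ qs) = f q ∷ All-map f qs

  All-∷ʳ : ∀ {Q x y z n} {w : x ⇝[ n ] y} {e : y ~ z} → All Q w → Q z → All Q (w ∷ʳ e)
  All-∷ʳ [ q ]    qz = q ∷ [ qz ]
  All-∷ʳ (q ∷ qs) qz = q ∷ All-∷ʳ qs qz

  All-reverse : ∀ {Q x y n} {w : x ⇝[ n ] y} → All Q w → All Q (reverse w)
  All-reverse [ q ]    = [ q ]
  All-reverse (q ∷ qs) = All-∷ʳ (All-reverse qs) q

  DistGe-intro : ∀ {x y r} → (∀ {n} → x ⇝[ n ] y → r ≤ n) → DistGe G x y r
  DistGe-intro bound W W-start W-end = bound (fromWalk W W-start W-end)

  DistGe-weaken : ∀ {x y r r'} → r' ≤ r → DistGe G x y r → DistGe G x y r'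
  DistGe-weaken r'≤r dist W W-start W-end = ≤-trans r'≤r (dist W W-start W-end)

  DistGe-elim : ∀ {x y r n} → DistGe G x y r → x ⇝[ n ] y → r ≤ n
  DistGe-elim dist w = dist (toWalk w) (vertex-first w) (vertex-last w)

  DistGe-sym : ∀ {x y r} → DistGe G x y r → DistGe G y x r
  DistGe-sym dist = DistGe-intro (λ w → DistGe-elim dist (reverse w))

  InBall-elim : ∀ {r x y} → InBall G r x y → ∃[ n ] n ≤ r × x ⇝[ n ] y
  InBall-elim (W , W-start , W-end , len≤r) = Walk.len W , len≤r , fromWalk W W-start W-end

  InBallMinus-intro : ∀ {u x y n} (w : x ⇝[ n ] y) → All (_≢ u) w → InBallMinus G u n x y
  InBallMinus-intro w avoids = toWalk w , vertex-first w , vertex-last w , ≤-refl , All-vertex avoids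

-- Vertices of a path indexed by ℕ; positions past the end denote the last vertex.
module PathGeometry (G : Graph) (P : Path G) where
  open Graph G
  open IndexedWalks G
  open Path P using (len; vtx; adj)

  clamp : ℕ → Fin (suc len)
  clamp r with r ≤? len
  ... | yes r≤len = fromℕ< (s≤s r≤len)
  ... | no  _     = fromℕ len

  toℕ-clamp : ∀ {r} → r ≤ len → toℕ (clamp r) ≡ r
  toℕ-clamp {r} r≤len with r ≤? len
  ... | yes r≤len′ = toℕ-fromℕ< (s≤s r≤len′)
  ... | no  r≰len  = ⊥-elim (r≰len r≤len)

  at : ℕ → V
  at r = vtx (clamp r)

  vtx≡at : ∀ k → vtx k ≡ at (toℕ k)
  vtx≡at k = cong vtx (toℕ-injective (sym (toℕ-clamp (≤-pred (toℕ<n k)))))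

  pend≡at-len : pend G P ≡ at len
  pend≡at-len = trans (vtx≡at (fromℕ len)) (cong at (toℕ-fromℕ len))

  at-adj : ∀ {r} → r < len → at r ~ at (suc r)
  at-adj {r} r<len = subst₂ _~_ (trans (vtx≡at (inject₁ k)) (cong at (trans (toℕ-inject₁ k) toℕ-k)))
                                (trans (vtx≡at (fsuc k)) (cong (at ∘ suc) toℕ-k))
                                (adj k)
    where
      k = fromℕ< r<len
      toℕ-k = toℕ-fromℕ< r<len

  at-injective : ∀ {r r'} → r ≤ len → r' ≤ len → at r ≡ at r' → r ≡ r'
  at-injective r≤ r'≤ e = trans (sym (toℕ-clamp r≤)) (trans (cong toℕ (Path.inj P e)) (toℕ-clamp r'≤))

  segment : ∀ j t → t + j ≤ len → at j ⇝[ t ] at (t + j)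
  segment j zero    _         = []
  segment j (suc t) t+j<len = segment j t (<⇒≤ t+j<len) ∷ʳ at-adj t+j<len

  Between : ℕ → ℕ → V → Set
  Between j k v = ∃[ r ] j ≤ r × r ≤ k × v ≡ at r

  segment-between : ∀ j t (t+j≤len : t + j ≤ len) → All (Between j (t + j)) (segment j t t+j≤len)
  segment-between j zero    _         = [ (j , ≤-refl , ≤-refl , refl) ]
  segment-between j (suc t) t+j<len =
    All-∷ʳ (All-map (λ (r , j≤r , r≤ , e) → r , j≤r , m≤n⇒m≤1+n r≤ , e) (segment-between j t _))
           (suc (t + j) , m≤n+m j (suc t) , ≤-refl , refl)

  module _ (geodesic : Geodesic G P) where

    distance-along : ∀ {j k n} → j ≤ k → k ≤ len → at j ⇝[ n ] at k → k ∸ j ≤ n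
    distance-along {j} {k} {n} j≤k k≤len w = m≤n+o⇒m∸n≤o k j k≤j+n
      where
        prefix : at 0 ⇝[ j ] at j
        prefix = subst (λ z → at 0 ⇝[ j ] at z) (+-identityʳ j)
                   (segment 0 j (≤-trans (≤-reflexive (+-identityʳ j)) (≤-trans j≤k k≤len)))
        suffix : at k ⇝[ len ∸ k ] at len
        suffix = subst (λ z → at k ⇝[ len ∸ k ] at z) (m∸n+n≡m k≤len)
                   (segment k (len ∸ k) (≤-reflexive (m∸n+n≡m k≤len)))
        len≤ : len ≤ j + (n + (len ∸ k))
        len≤ = DistGe-elim (subst₂ (λ x y → DistGe G x y len) (vtx≡at fzero) pend≡at-len geodesic)
                           (prefix ++ w ++ suffix)
        k≤j+n : k ≤ j + n
        k≤j+n = +-cancelʳ-≤ (len ∸ k) k (j + n) (begin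
          k + (len ∸ k)        ≡⟨ m+[n∸m]≡n k≤len ⟩
          len                  ≤⟨ len≤ ⟩
          j + (n + (len ∸ k))  ≡⟨ +-assoc j n (len ∸ k) ⟨
          j + n + (len ∸ k)    ∎)
          where open ≤-Reasoning

    distance-to-start : ∀ k → DistGe G (vtx k) (pstart G P) (toℕ k)
    distance-to-start k = DistGe-intro λ w →
      distance-along z≤n (≤-pred (toℕ<n k)) (reverse (subst₂ (λ x y → x ⇝[ _ ] y) (vtx≡at k) (vtx≡at fzero) w))

    distance-to-end : ∀ k → DistGe G (vtx k) (pend G P) (len ∸ toℕ k)
    distance-to-end k = DistGe-intro λ w →
      distance-along (≤-pred (toℕ<n k)) ≤-refl (subst₂ (λ x y → x ⇝[ _ ] y) (vtx≡at k) pend≡at-len w)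

  -- Whichever side of v = at (s + a) the vertex u lies on, the segment on the
  -- other side avoids u; walking through u then joins x = at a and
  -- y = at (s + (s + a)), which are 2s apart, in fewer than 2s steps.
  module _ (geodesic : Geodesic G P) {s a : ℕ} {u : V}
           (1≤s : 1 ≤ s) (fits : s + (s + a) ≤ len) (u≢v : u ≢ at (s + a))
           (ball-left  : InBallMinus G u s (at (s + a)) (at a) → InBall G (s ∸ 1) u (at a))
           (ball-right : InBallMinus G u s (at (s + a)) (at (s + (s + a))) → InBall G (s ∸ 1) u (at (s + (s + a))))
           where

    private
      x v y : V
      x = at a
      v = at (s + a)
      y = at (s + (s + a))

      ≤∸1⇒< : ∀ {n} → n ≤ s ∸ 1 → n < s
      ≤∸1⇒< = ≤pred⇒< 1≤s
        where
          ≤pred⇒< : ∀ {n m} → 1 ≤ m → n ≤ m ∸ 1 → n < m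
          ≤pred⇒< (s≤s z≤n) = s≤s

      s+a≤len : s + a ≤ len
      s+a≤len = ≤-trans (m≤n+m (s + a) s) fits

      ends-far : ∀ {n} → x ⇝[ n ] y → s + s ≤ n
      ends-far {n} w = subst (_≤ n) span
        (distance-along geodesic {a} {s + (s + a)} (≤-trans (m≤n+m a s) (m≤n+m (s + a) s)) fits w)
        where
          span : s + (s + a) ∸ a ≡ s + s
          span = trans (cong (_∸ a) (sym (+-assoc s s a))) (m+n∸n≡m (s + s) a)

      Left Right : Set
      Left  = Between a (s + a) u
      Right = Between (s + a) (s + (s + a)) u

      avoids : ∀ {j k w₁ w₂ n} {w : w₁ ⇝[ n ] w₂} → ¬ Between j k u → All (Between j k) w → All (_≢ u) w
      avoids ¬between = All-map λ (r , j≤r , r≤k , w≡at) w≡u → ¬between (r , j≤r , r≤k , trans (sym w≡u) w≡at)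

      left-walk : v ⇝[ s ] x
      left-walk = reverse (segment a s s+a≤len)

      right-walk : v ⇝[ s ] y
      right-walk = segment (s + a) s fits

      near-x : ¬ Left → ∃[ n ] n < s × x ⇝[ n ] u
      near-x ¬left with InBall-elim (ball-left (InBallMinus-intro left-walk
                          (avoids ¬left (All-reverse (segment-between a s s+a≤len)))))
      ... | n , n≤ , w = n , ≤∸1⇒< n≤ , reverse w

      near-y : ¬ Right → ∃[ n ] n < s × u ⇝[ n ] y
      near-y ¬right with InBall-elim (ball-right (InBallMinus-intro right-walk
                           (avoids ¬right (segment-between (s + a) s fits))))
      ... | n , n≤ , w = n , ≤∸1⇒< n≤ , w

      short-detour : ∀ {n n'} → n < s → n' < s → x ⇝[ n ] u → u ⇝[ n' ] y → ⊥
      short-detour n<s n'<s w w' = <⇒≱ (+-mono-< n<s n'<s) (ends-far (w ++ w'))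

      neither-side : ¬ Left → ¬ Right → ⊥
      neither-side ¬left ¬right =
        let _ , n<s , w = near-x ¬left ; _ , n'<s , w' = near-y ¬right in short-detour n<s n'<s w w'

      ¬left×right : Left → Right → ⊥
      ¬left×right (r , _ , r≤ , u≡r) (r' , ≤r' , r'≤ , u≡r') =
        u≢v (subst (λ z → u ≡ at z) (≤-antisym r≤ (subst (s + a ≤_) (sym r≡r') ≤r')) u≡r)
        where
          r≡r' : r ≡ r'
          r≡r' = at-injective (≤-trans r≤ s+a≤len) (≤-trans r'≤ fits) (trans (sym u≡r) u≡r')

      left-case : Left → ⊥
      left-case left@(r , a≤r , r≤ , u≡r) with near-y (¬left×right left)
      ... | n' , n'<s , w' = short-detour (+-cancelʳ-< a (r ∸ a) s r∸a+a<s+a) n'<s x⇝u w'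
        where
          r<s+a : r < s + a
          r<s+a = ≤∧≢⇒< r≤ λ r≡s+a → u≢v (trans u≡r (cong at r≡s+a))
          r∸a+a<s+a : r ∸ a + a < s + a
          r∸a+a<s+a = subst (_< s + a) (sym (m∸n+n≡m a≤r)) r<s+a
          x⇝u : x ⇝[ r ∸ a ] u
          x⇝u = subst (λ z → x ⇝[ r ∸ a ] z) (trans (cong at (m∸n+n≡m a≤r)) (sym u≡r))
                      (segment a (r ∸ a) (≤-trans (≤-reflexive (m∸n+n≡m a≤r)) (≤-trans r≤ s+a≤len)))

      right-case : ¬ Left → Right → ⊥
      right-case ¬left (r , ≤r , r≤ , u≡r) with near-x ¬left
      ... | n , n<s , w = short-detour n<s rest<s w u⇝y
        where
          s+a<r : s + a < r
          s+a<r = ≤∧≢⇒< ≤r λ s+a≡r → u≢v (trans u≡r (cong at (sym s+a≡r)))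
          rest<s : s + (s + a) ∸ r < s
          rest<s = subst (s + (s + a) ∸ r <_) (m+n∸n≡m s (s + a)) (∸-monoʳ-< s+a<r r≤)
          u⇝y : u ⇝[ s + (s + a) ∸ r ] y
          u⇝y = subst₂ (λ z z' → z ⇝[ s + (s + a) ∸ r ] z') (sym u≡r) (cong at (m∸n+n≡m r≤))
                       (segment r (s + (s + a) ∸ r) (≤-trans (≤-reflexive (m∸n+n≡m r≤)) fits))

    ¬dominated : ⊥
    ¬dominated = ¬¬-excluded-middle λ where
      (yes left) → left-case left
      (no ¬left) → ¬¬-excluded-middle λ where
        (yes right) → right-case ¬left right
        (no ¬right) → neither-side ¬left ¬right

module CoveredCycle (G : Graph) (n : ℕ) (3≤N : 3 ≤ suc n) (cv : Fin (suc n) → Graph.V G)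
                    (cv-inj : Injective _≡_ _≡_ cv)
                    (cv-adj : ∀ k → Graph._~_ G (atMod G 3≤N cv k) (atMod G 3≤N cv (suc k))) where
  open Graph G
  open Modular n
  open IndexedWalks G

  cycle : Cycle G
  cycle = record { len = N ; len≥3 = 3≤N ; cv = cv ; inj = cv-inj ; adj = cv-adj }

  at : ℕ → V
  at = Cycle.at cycle

  at-injective : ∀ {k k'} → at k ≡ at k' → k ≡ₙ k'
  at-injective {k} {k'} e =
    modeq (trans (sym (toℕ-fromℕ< (m%n<n k N))) (trans (cong toℕ (cv-inj e)) (toℕ-fromℕ< (m%n<n k' N))))

  at-cong : ∀ {k k'} → k ≡ₙ k' → at k ≡ at k'
  at-cong {k} {k'} (modeq e) =
    cong cv (toℕ-injective (trans (toℕ-fromℕ< (m%n<n k N)) (trans e (sym (toℕ-fromℕ< (m%n<n k' N))))))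

  at≡at-mod : ∀ q → at q ≡ at (toℕ (q mod N))
  at≡at-mod q = at-cong {q} {toℕ (q mod N)} (modeq (trans (sym (m%n%n≡m%n q N)) (cong (_% N) (sym (toℕ-fromℕ< (m%n<n q N))))))

  walk-around : ∀ q r → at q ⇝[ r ] at (r + q)
  walk-around q zero    = []
  walk-around q (suc r) = walk-around q r ∷ʳ cv-adj (r + q)

  EdgeForm : V → V → ℕ → Set
  EdgeForm x y p = (x ≡ at p × y ≡ at (suc p)) ⊎ (y ≡ at p × x ≡ at (suc p))

  -- Needs N ≥ 3: on a 2-cycle both orientations of an edge coincide.
  ¬flipped : ∀ {p p'} → p ≡ₙ suc p' → suc p ≡ₙ p' → ⊥
  ¬flipped {p} {p'} p≡p'+1 p+1≡p' with <N⇒≡ₙ⇒≡ {2} {0} 3≤N (s≤s z≤n) (+-cancelˡ p' (begin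
    p' + 2        ≡⟨ +-comm p' 2 ⟩
    suc (suc p')  ≈⟨ +-congˡ 1 p≡p'+1 ⟨
    suc p         ≈⟨ p+1≡p' ⟩
    p'            ≡⟨ +-identityʳ p' ⟨
    p' + 0        ∎))
    where open ≡ₙ-Reasoning
  ... | ()

  EdgeForm-unique : ∀ {x y p p'} → EdgeForm x y p → EdgeForm x y p' → p ≡ₙ p'
  EdgeForm-unique (inj₁ (x≡ , _))  (inj₁ (x≡′ , _))  = at-injective (trans (sym x≡) x≡′)
  EdgeForm-unique (inj₂ (y≡ , _))  (inj₂ (y≡′ , _))  = at-injective (trans (sym y≡) y≡′)
  EdgeForm-unique (inj₁ (x≡ , y≡)) (inj₂ (y≡′ , x≡′)) =
    ⊥-elim (¬flipped (at-injective (trans (sym x≡) x≡′)) (at-injective (trans (sym y≡) y≡′)))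
  EdgeForm-unique (inj₂ (y≡ , x≡)) (inj₁ (x≡′ , y≡′)) =
    ⊥-elim (¬flipped (at-injective (trans (sym y≡) y≡′)) (at-injective (trans (sym x≡) x≡′)))

  EdgeForm-incident : ∀ {x y p q} → EdgeForm x y p → at q ≡ x ⊎ at q ≡ y → p ≡ₙ q ⊎ p + 1 ≡ₙ q
  EdgeForm-incident (inj₁ (x≡ , _)) (inj₁ q≡x) = inj₁ (at-injective (trans (sym x≡) (sym q≡x)))
  EdgeForm-incident (inj₁ (_ , y≡)) (inj₂ q≡y) =
    inj₂ (≡ₙ-trans (≡⇒≡ₙ (+-comm _ 1)) (at-injective (trans (sym y≡) (sym q≡y))))
  EdgeForm-incident (inj₂ (_ , x≡)) (inj₁ q≡x) =
    inj₂ (≡ₙ-trans (≡⇒≡ₙ (+-comm _ 1)) (at-injective (trans (sym x≡) (sym q≡x))))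
  EdgeForm-incident (inj₂ (y≡ , _)) (inj₂ q≡y) = inj₁ (at-injective (trans (sym y≡) (sym q≡y)))

  cycle-subgraph : Subgraph G
  cycle-subgraph = record
    { VS     = λ x → ∃[ q ] x ≡ at q
    ; ES     = λ x y → ∃[ p ] EdgeForm x y p
    ; ES-adj = λ where
        (p , inj₁ (x≡ , y≡)) → subst₂ _~_ (sym x≡) (sym y≡) (cv-adj p)
        (p , inj₂ (y≡ , x≡)) → ~-sym (subst₂ _~_ (sym y≡) (sym x≡) (cv-adj p))
    ; ES-sym = λ where
        (p , inj₁ e) → p , inj₂ e
        (p , inj₂ e) → p , inj₁ e
    ; ES-vtx = λ where
        (p , inj₁ (x≡ , y≡)) → (p , x≡) , (suc p , y≡)
        (p , inj₂ (y≡ , x≡)) → (suc p , x≡) , (p , y≡) }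

  cycle-subgraph-finite : FiniteSub G cycle-subgraph
  cycle-subgraph-finite = List.map (at ∘ toℕ) (allFin N) , λ where
    x (q , refl) → subst (_∈ List.map (at ∘ toℕ) (allFin N)) (sym (at≡at-mod q))
                         (∈-map⁺ (at ∘ toℕ) (∈-allFin (q mod N)))

  module Cover (s m : ℕ) (P : Fin m → Path G)
               (geodesic-subpath : ∀ i → Geodesic G (P i) × SubpathOf G (P i) cycle)
               (covers-edges : ∀ e → ∃[ i ] EdgeOf G (P i) (at e) (at (suc e)))
               (disjoint-paths : ∀ i j → i ≢ j → ¬ Consec G m i j → ¬ Consec G m j i → EdgeDisjoint G (P i) (P j))
               (overlaps : ∀ i j → Consec G m i j → IntersectionIsPathGe G (P i) (P j) (2 * s))
               (1≤s : 1 ≤ s) where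
    open CycleArcs n s m

    geodesic : ∀ i → Geodesic G (P i)
    geodesic i = proj₁ (geodesic-subpath i)

    len : Fin m → ℕ
    len i = Path.len (P i)

    origin : Fin m → ℕ
    origin i = proj₁ (proj₂ (proj₂ (geodesic-subpath i)))

    orientation : ∀ i → (∀ k → Path.vtx (P i) k ≡ at (origin i + toℕ k))
                      ⊎ (∀ k → Path.vtx (P i) k ≡ at (origin i + (len i ∸ toℕ k)))
    orientation i = proj₂ (proj₂ (proj₂ (geodesic-subpath i)))

    arcSystem : ArcSystem
    arcSystem = arcs origin len

    vertex-offset : ∀ i k → ∃[ t ] t ≤ len i × Path.vtx (P i) k ≡ at (origin i + t)
    vertex-offset i k with orientation i
    ... | inj₁ fwd = toℕ k , ≤-pred (toℕ<n k) , fwd k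
    ... | inj₂ bwd = len i ∸ toℕ k , m∸n≤m (len i) (toℕ k) , bwd k

    offset-vertex : ∀ i {t} → t ≤ len i →
                    ∃[ k ] Path.vtx (P i) k ≡ at (origin i + t) × (toℕ k ≡ t ⊎ toℕ k ≡ len i ∸ t)
    offset-vertex i {t} t≤ with orientation i
    ... | inj₁ fwd = k , trans (fwd k) (cong (λ z → at (origin i + z)) toℕ-k) , inj₁ toℕ-k
      where
        k = fromℕ< (s≤s t≤)
        toℕ-k = toℕ-fromℕ< (s≤s t≤)
    ... | inj₂ bwd =
      k , trans (bwd k) (cong (λ z → at (origin i + z)) (trans (cong (len i ∸_) toℕ-k) (m∸[m∸n]≡n t≤))) ,
      inj₂ toℕ-k
      where
        k = fromℕ< (s≤s (m∸n≤m (len i) t))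
        toℕ-k = toℕ-fromℕ< (s≤s (m∸n≤m (len i) t))

    step-offset : ∀ i (k : Fin (len i)) →
                  ∃[ u ] u < len i × EdgeForm (Path.vtx (P i) (inject₁ k)) (Path.vtx (P i) (fsuc k)) (origin i + u)
    step-offset i k with orientation i
    ... | inj₁ fwd = toℕ k , toℕ<n k ,
      inj₁ (trans (fwd (inject₁ k)) (cong (λ z → at (origin i + z)) (toℕ-inject₁ k)) ,
            trans (fwd (fsuc k)) (cong at (+-suc (origin i) (toℕ k))))
    ... | inj₂ bwd = u , ∸-monoʳ-< (s≤s z≤n) (toℕ<n k) ,
      inj₂ (bwd _ , trans (bwd _) (cong at (trans (cong (origin i +_) ℓ∸k≡1+u) (+-suc _ _))))
      where
        u = len i ∸ suc (toℕ k)
        ℓ∸k≡1+u : len i ∸ toℕ (inject₁ k) ≡ suc u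
        ℓ∸k≡1+u = trans (cong (len i ∸_) (toℕ-inject₁ k)) (+-∸-assoc 1 (toℕ<n k))

    edge-offset : ∀ i {x y} → EdgeOf G (P i) x y → ∃[ u ] u < len i × EdgeForm x y (origin i + u)
    edge-offset i (k , inj₁ (x≡ , y≡)) with step-offset i k
    ... | u , u< , form = u , u< , subst₂ (λ x y → EdgeForm x y _) (sym x≡) (sym y≡) form
    edge-offset i (k , inj₂ (y≡ , x≡)) with step-offset i k
    ... | u , u< , form = u , u< , subst₂ (λ x y → EdgeForm x y _) (sym x≡) (sym y≡) (Data.Sum.swap form)

    offset-edge : ∀ i {u} → u < len i → EdgeOf G (P i) (at (origin i + u)) (at (suc (origin i + u)))
    offset-edge i {u} u< with orientation i
    ... | inj₁ fwd = k , inj₁ (sym (trans (fwd _) (cong (λ z → at (origin i + z)) (trans (toℕ-inject₁ k) toℕ-k))) ,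
                               sym (trans (fwd _) (cong at (trans (cong (λ z → origin i + suc z) toℕ-k) (+-suc _ _)))))
      where
        k = fromℕ< u<
        toℕ-k = toℕ-fromℕ< u<
    ... | inj₂ bwd = k , inj₂ (sym (trans (bwd _) (cong at (trans (cong (origin i +_) ℓ∸k≡1+u) (+-suc _ _)))) ,
                               sym (trans (bwd _) (cong (λ z → at (origin i + z)) ℓ∸[k+1]≡u)))
      where
        ℓ∸1+u<ℓ = ∸-monoʳ-< (s≤s z≤n) u<
        k = fromℕ< ℓ∸1+u<ℓ
        toℕ-k = toℕ-fromℕ< ℓ∸1+u<ℓ
        ℓ∸k≡1+u : len i ∸ toℕ (inject₁ k) ≡ suc u
        ℓ∸k≡1+u = trans (cong (len i ∸_) (trans (toℕ-inject₁ k) toℕ-k)) (m∸[m∸n]≡n u<)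
        ℓ∸[k+1]≡u : len i ∸ suc (toℕ k) ≡ u
        ℓ∸[k+1]≡u = suc-injective
          (trans (sym (+-∸-assoc 1 (toℕ<n k))) (trans (cong (len i ∸_) toℕ-k) (m∸[m∸n]≡n u<)))

    EdgeOnArc⇒EdgeOf : ∀ {i e} → EdgeOnArc arcSystem i e → EdgeOf G (P i) (at e) (at (suc e))
    EdgeOnArc⇒EdgeOf {i} (u , u< , at≡) = subst₂ (EdgeOf G (P i)) (at-cong at≡) (at-cong (+-congˡ 1 at≡)) (offset-edge i u<)

    EdgeOf⇒EdgeOnArc : ∀ {i e} → EdgeOf G (P i) (at e) (at (suc e)) → EdgeOnArc arcSystem i e
    EdgeOf⇒EdgeOnArc {i} E with edge-offset i E
    ... | u , u< , form = u , u< , EdgeForm-unique form (inj₁ (refl , refl))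

    VtxOf⇒OnArc : ∀ {i x} → VtxOf G (P i) x → ∃[ q ] x ≡ at q × OnArc arcSystem i q
    VtxOf⇒OnArc {i} (k , x≡) with vertex-offset i k
    ... | t , t≤ , vk = origin i + t , trans x≡ vk , t , t≤ , ≡ₙ-refl

    OnArc⇒VtxOf : ∀ {i q} → OnArc arcSystem i q → VtxOf G (P i) (at q)
    OnArc⇒VtxOf {i} (t , t≤ , at≡) with offset-vertex i t≤
    ... | k , vk , _ = k , sym (trans vk (at-cong at≡))

    record Overlap (i j : Fin m) : Set where
      field
        R      : Path G
        long   : 2 * s ≤ Path.len R
        vertex⁺ : ∀ {x} → VtxOf G (P i) x → VtxOf G (P j) x → VtxOf G R x
        vertex⁻ : ∀ {x} → VtxOf G R x → VtxOf G (P i) x × VtxOf G (P j) x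
        edge⁻   : ∀ {x y} → EdgeOf G R x y → EdgeOf G (P i) x y × EdgeOf G (P j) x y

    overlap-of : ∀ {i j} → Adjacent i j → Overlap i j
    overlap-of {i} {j} (inj₁ i→j) with overlaps i j i→j
    ... | R , long , vtx⇔ , edge⇔ = record
      { R = R ; long = long
      ; vertex⁺ = λ onᵢ onⱼ → Equivalence.to (vtx⇔ _) (onᵢ , onⱼ)
      ; vertex⁻ = Equivalence.from (vtx⇔ _)
      ; edge⁻   = Equivalence.from (edge⇔ _ _) }
    overlap-of {i} {j} (inj₂ j→i) with overlaps j i j→i
    ... | R , long , vtx⇔ , edge⇔ = record
      { R = R ; long = long
      ; vertex⁺ = λ onᵢ onⱼ → Equivalence.to (vtx⇔ _) (onⱼ , onᵢ)
      ; vertex⁻ = Data.Product.swap ∘ Equivalence.from (vtx⇔ _)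
      ; edge⁻   = Data.Product.swap ∘ Equivalence.from (edge⇔ _ _) }

    module _ {i j} (adj : Adjacent i j) where
      open Overlap (overlap-of adj)

      shared-edge-through : ∀ {q} → OnArc arcSystem i q → OnArc arcSystem j q →
                            ∃[ e ] EdgeOnArc arcSystem i e × EdgeOnArc arcSystem j e × (e ≡ₙ q ⊎ e + 1 ≡ₙ q)
      shared-edge-through {q} onᵢ onⱼ with vertex⁺ (OnArc⇒VtxOf onᵢ) (OnArc⇒VtxOf onⱼ)
      ... | r , q≡r with incident-edge (≤-trans (≤-trans 1≤s (m≤m+n s _)) long) r
      ... | k , r-end with edge⁻ (k , inj₁ (refl , refl))
      ... | Eᵢ , Eⱼ with edge-offset i Eᵢ | edge-offset j Eⱼ
      ... | u , u< , formᵢ | u' , u'< , formⱼ =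
        origin i + u , (u , u< , ≡ₙ-refl) , (u' , u'< , EdgeForm-unique formⱼ formᵢ) ,
        EdgeForm-incident formᵢ q-on-edge
        where
          q-on-edge : at q ≡ Path.vtx R (inject₁ k) ⊎ at q ≡ Path.vtx R (fsuc k)
          q-on-edge = Data.Sum.map (λ e → trans q≡r (cong (Path.vtx R) (sym e)))
                                   (λ e → trans q≡r (cong (Path.vtx R) (sym e))) r-end

      shared-vertices : Σ (Fin (suc (2 * s)) → ℕ) λ f →
                          (∀ r r' → f r ≡ₙ f r' → r ≡ r') × (∀ r → OnArc arcSystem i (f r) × OnArc arcSystem j (f r))
      shared-vertices = proj₁ ∘ shared , f-injective , proj₂ ∘ proj₂ ∘ shared
        where
          index : Fin (suc (2 * s)) → Fin (suc (Path.len R))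
          index r = inject≤ r (s≤s long)

          shared : ∀ r → ∃[ q ] Path.vtx R (index r) ≡ at q × OnArc arcSystem i q × OnArc arcSystem j q
          shared r with vertex⁻ (index r , refl)
          ... | vᵢ , vⱼ with VtxOf⇒OnArc vᵢ | VtxOf⇒OnArc vⱼ
          ... | qᵢ , ≡qᵢ , onᵢ | qⱼ , ≡qⱼ , onⱼ =
            qⱼ , ≡qⱼ , OnArc-resp arcSystem onᵢ (at-injective (trans (sym ≡qᵢ) ≡qⱼ)) , onⱼ

          f-injective : ∀ r r' → proj₁ (shared r) ≡ₙ proj₁ (shared r') → r ≡ r'
          f-injective r r' e = inject≤-injective (s≤s long) (s≤s long) r r'
            (Path.inj R (trans (proj₁ (proj₂ (shared r))) (trans (at-cong e) (sym (proj₁ (proj₂ (shared r')))))))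

    len≥1 : ∀ i → 1 ≤ len i
    len≥1 i = ≤-trans (s≤s z≤n) (toℕ<n (proj₁ (proj₁ (edge⁻ (fromℕ< 1≤len-R , inj₁ (refl , refl))))))
      where
        open Overlap (overlap-of (inj₁ (proj₂ (cyclicSucc i))))
        1≤len-R = ≤-trans (≤-trans 1≤s (m≤m+n s _)) long

    ends-distance : ∀ i → DistGe G (at (origin i + len i)) (at (origin i)) (len i)
    ends-distance i with orientation i
    ... | inj₁ fwd = DistGe-sym (subst₂ (λ x y → DistGe G x y (len i))
                       (trans (fwd fzero) (cong at (+-identityʳ (origin i))))
                       (trans (fwd (fromℕ (len i))) (cong (λ z → at (origin i + z)) (toℕ-fromℕ (len i))))
                       (geodesic i))
    ... | inj₂ bwd = subst₂ (λ x y → DistGe G x y (len i))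
                       (bwd fzero)
                       (trans (bwd (fromℕ (len i)))
                              (cong at (trans (cong (λ z → origin i + (len i ∸ z)) (toℕ-fromℕ (len i)))
                                              (trans (cong (origin i +_) (n∸n≡0 (len i))) (+-identityʳ (origin i))))))
                       (geodesic i)

    -- The rest of the cycle also joins the ends of a geodesic arc.
    len+len≤N : ∀ i → len i + len i ≤ N
    len+len≤N i = m≤o∸n⇒m+n≤o (len i) len≤N (DistGe-elim (ends-distance i) around)
      where
        len≤N : len i ≤ N
        len≤N = <⇒≤ (proj₁ (proj₂ (geodesic-subpath i)))
        wraps : N ∸ len i + (origin i + len i) ≡ₙ origin i
        wraps = begin
          N ∸ len i + (origin i + len i)   ≡⟨ +-comm (N ∸ len i) _ ⟩
          origin i + len i + (N ∸ len i)   ≡⟨ +-assoc (origin i) (len i) _ ⟩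
          origin i + (len i + (N ∸ len i)) ≡⟨ cong (origin i +_) (m+[n∸m]≡n len≤N) ⟩
          origin i + N                     ≈⟨ m+N≡ₙm (origin i) ⟩
          origin i                         ∎
          where open ≡ₙ-Reasoning
        around : at (origin i + len i) ⇝[ N ∸ len i ] at (origin i)
        around = subst (at (origin i + len i) ⇝[ N ∸ len i ]_) (at-cong wraps) (walk-around (origin i + len i) (N ∸ len i))

    covering : Covering arcSystem
    covering = record
      { len+len≤N = len+len≤N
      ; len≥1     = len≥1
      ; covers    = λ e → map₂ EdgeOf⇒EdgeOnArc (covers-edges e)
      ; disjoint  = λ i j i≢j ¬i→j ¬j→i e onᵢ onⱼ →
          disjoint-paths i j i≢j ¬i→j ¬j→i (at e) (at (suc e)) (EdgeOnArc⇒EdgeOf onᵢ , EdgeOnArc⇒EdgeOf onⱼ)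
      ; shared-vertex-on-shared-edge = λ i j adj q → shared-edge-through adj
      ; shared-vertices = λ i j adj → shared-vertices adj }

    deep-vertex : ∀ q → ∃₂ λ i k → Path.vtx (P i) k ≡ at q × s ≤ toℕ k × s ≤ len i ∸ toℕ k
    deep-vertex q with deep covering q
    ... | i , t , (t≤ , at≡) , s≤t , s≤rest with offset-vertex i t≤
    ...   | k , vk , inj₁ k≡t = i , k , trans vk (at-cong at≡) ,
            subst (s ≤_) (sym k≡t) s≤t , subst (λ z → s ≤ len i ∸ z) (sym k≡t) s≤rest
    ...   | k , vk , inj₂ k≡rest = i , k , trans vk (at-cong at≡) ,
            subst (s ≤_) (sym k≡rest) s≤rest ,
            subst (λ z → s ≤ len i ∸ z) (sym k≡rest) (subst (s ≤_) (sym (m∸[m∸n]≡n t≤)) s≤t)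

    locally-isometric : LocallyIsometric G s cycle-subgraph
    locally-isometric = (λ Q → ∃[ i ] P i ≡ Q) , on-cycle , deep-cover
      where
        on-cycle : ∀ Q → ∃[ i ] P i ≡ Q → Geodesic G Q × PathIn G Q cycle-subgraph
        on-cycle _ (i , refl) = geodesic i ,
          (λ x v → let q , x≡ , _ = VtxOf⇒OnArc v in q , x≡) ,
          (λ x y E → let u , _ , form = edge-offset i E in origin i + u , form)

        deep-cover : ∀ v → Subgraph.VS cycle-subgraph v →
                     ∃[ Q ] ((∃[ i ] P i ≡ Q) × VtxOf G Q v × DistGe G v (pstart G Q) s × DistGe G v (pend G Q) s)
        deep-cover v (q , refl) with deep-vertex q
        ... | i , k , vk , s≤k , s≤rest = P i , (i , refl) , (k , sym vk) ,
          subst (λ z → DistGe G z (pstart G (P i)) s) vk (DistGe-weaken s≤k (distance-to-start (geodesic i) k)) ,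
          subst (λ z → DistGe G z (pend G (P i)) s) vk (DistGe-weaken s≤rest (distance-to-end (geodesic i) k))
          where open PathGeometry G (P i)

    -- The top vertex v of the cycle in the dismantling order is deep in some
    -- geodesic, while every vertex of that geodesic lies below v.
    module Dismantling (O : WellOrder G) where
      module O = WellOrder O
      open O using (_≼_)

      top : Σ (Fin N) λ k → ∀ j → at (toℕ j) ≼ at (toℕ k)
      top = Fin-argmax _≼_ (λ {x} → O.refl x) O.trans O.total fzero (λ (j : Fin N) → at (toℕ j))

      v : V
      v = at (toℕ (proj₁ top))

      below-top : ∀ q → at q ≼ v
      below-top q = subst (_≼ v) (sym (at≡at-mod q)) (proj₂ top (q mod N))

      top-not-least : ¬ (∀ w → v ≼ w)
      top-not-least v-least = ~-irr (subst (v ~_) (sym v≡next) (cv-adj (toℕ (proj₁ top))))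
        where v≡next = O.antisym (v-least _) (below-top (suc (toℕ (proj₁ top))))

      path-below-top : ∀ i k → Path.vtx (P i) k ≼ v
      path-below-top i k = let q , vk≡q , _ = VtxOf⇒OnArc {i} (k , refl) in subst (_≼ v) (sym vk≡q) (below-top q)

      top-not-dominated : ∀ {u} → u ≢ v → (∀ x → InBallMinus G u s v x → x ≼ v → InBall G (s ∸ 1) u x) → ⊥
      top-not-dominated {u} u≢v ball-condition with deep-vertex (toℕ (proj₁ top))
      ... | i , k , vk , s≤k , s≤rest =
        ¬dominated (geodesic i) {s} {a} {u} 1≤s fits (λ u≡ → u≢v (trans u≡ atᵢ[s+a]≡v)) (ball a) (ball (s + (s + a)))
        where
          open PathGeometry G (P i) renaming (at to atᵢ)
          a = toℕ k ∸ s
          s+a≡k : s + a ≡ toℕ k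
          s+a≡k = m+[n∸m]≡n s≤k
          fits : s + (s + a) ≤ len i
          fits = subst (λ z → s + z ≤ len i) (sym s+a≡k) (m≤o∸n⇒m+n≤o s (≤-pred (toℕ<n k)) s≤rest)
          atᵢ[s+a]≡v : atᵢ (s + a) ≡ v
          atᵢ[s+a]≡v = trans (cong atᵢ s+a≡k) (trans (sym (vtx≡at k)) vk)
          ball : ∀ r → InBallMinus G u s (atᵢ (s + a)) (atᵢ r) → InBall G (s ∸ 1) u (atᵢ r)
          ball r inside = ball-condition (atᵢ r) (subst (λ z → InBallMinus G u s z (atᵢ r)) atᵢ[s+a]≡v inside)
                                         (path-below-top i (clamp r))

    ¬dismantlable : Dismantlable G s (s ∸ 1) → ⊥
    ¬dismantlable (O , dominated) =
      let u , u≢v , _ , ball-condition = dominated v top-not-least in top-not-dominated u≢v ball-condition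
      where open Dismantling O

lemma4 : (G : Graph) → Connected G → (s : ℕ) → 1 ≤ s →
    (HasGeodCoveredCycle G s →
       ∃[ H ] (NonEmptySub G H × FiniteSub G H × LocallyIsometric G s H))
    × (Dismantlable G s (s ∸ 1) → ¬ HasGeodCoveredCycle G s)
lemma4 G _ s 1≤s = (λ (c , covered) → locally-isometric-subgraph c covered)
                 , (λ dismantlable (c , covered) → not-dismantlable c covered dismantlable)
  where
    locally-isometric-subgraph : (c : Cycle G) → GeodesicallyCovered G s c →
                                 ∃[ H ] (NonEmptySub G H × FiniteSub G H × LocallyIsometric G s H)
    locally-isometric-subgraph record { len = suc n ; len≥3 = 3≤N ; cv = cv ; inj = inj ; adj = adj }
                               (m , P , geodesic-subpath , covers , disjoint , overlaps) =
      cycle-subgraph , (at 0 , 0 , refl) , cycle-subgraph-finite , locally-isometric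
      where
        open CoveredCycle G n 3≤N cv inj adj
        open Cover s m P geodesic-subpath covers disjoint overlaps 1≤s

    not-dismantlable : (c : Cycle G) → GeodesicallyCovered G s c → ¬ Dismantlable G s (s ∸ 1)
    not-dismantlable record { len = suc n ; len≥3 = 3≤N ; cv = cv ; inj = inj ; adj = adj }
                     (m , P , geodesic-subpath , covers , disjoint , overlaps) =
      ¬dismantlable
      where
        open CoveredCycle G n 3≤N cv inj adj
        open Cover s m P geodesic-subpath covers disjoint overlaps 1≤s
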